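{- For all $m\ge1$, every permutation $\pi\in S_{2^m}$ with $x_m\le\pi\le y_m$ in the Bruhat order is dyadically well-distributed, i.e. $[x_m,y_m]\subseteq\mathrm{DWD}_m$.
   Context: Let $[n]=\{0,\dots,n-1\}$, $S_n$ the bijections of $[n]$. A basic $k$-interval ($0\le k\le m$) is $\{c2^k,\dots,(c+1)2^k-1\}\subseteq[2^m]$. $\pi\in S_{2^m}$ is dyadically well-distributed if for every basic $k_1$-interval $S$ and basic $k_2$-interval $T$ with $k_1+k_2=m$ there is exactly one $i\in S$ with $\pi(i)\in T$; $\mathrm{DWD}_m$ is the set of these. Define $x_1=(0,1)$ (one-line notation) and $x_{m+1}=(x_m(0),x_m(0)+2^m,x_m(1),x_m(1)+2^m,\dots,x_m(2^m-1),x_m(2^m-1)+2^m)$; $y_m$ is the reversal of $x_m$ in one-line notation. Length is the number of inversions; Bruhat order: $\pi_1\le\pi_2$ iff $\pi_2=\pi_1t_1\cdots t_k$ for transpositions $t_i$ with lengths of successive partial products strictly increasing. -}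

module Defs where

open import Data.Nat using (ℕ; zero; suc; _+_; _*_; _^_; _≤_; _<_; _<?_)
open import Data.List using (List; []; _∷_; length; filter; concatMap; reverse; upTo)
open import Data.Product using (Σ; _×_)
open import Relation.Binary.PropositionalEquality using (_≡_)

-- Permutations of [n] are represented in one-line notation as lists of
-- naturals (w = (w(0), …, w(n-1))).

-- entry at position i (default 0 out of range)
at : List ℕ → ℕ → ℕ
at []       _       = 0
at (x ∷ xs) zero    = x
at (x ∷ xs) (suc i) = at xs i

setAt : List ℕ → ℕ → ℕ → List ℕ
setAt []       _       v = []
setAt (x ∷ xs) zero    v = v ∷ xs
setAt (x ∷ xs) (suc i) v = x ∷ setAt xs i v

-- w · (i j) : right multiplication by the transposition (i j),
-- i.e. swap the entries in positions i and j
swapPos : List ℕ → ℕ → ℕ → List ℕ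
swapPos w i j = setAt (setAt w i (at w j)) j (at w i)

inv : List ℕ → ℕ
inv []       = 0
inv (x ∷ xs) = length (filter (_<? x) xs) + inv xs

-- Bruhat order: u ≤B w iff w = u t₁ ⋯ t_k (k ≥ 0) with transpositions t_i
-- and the lengths of successive partial products strictly increasing.
data _≤B_ : List ℕ → List ℕ → Set where
  ≤B-refl : ∀ {u} → u ≤B u
  ≤B-step : ∀ {u w} (i j : ℕ) → i < j → j < length w → u ≤B w →
            inv w < inv (swapPos w i j) → u ≤B swapPos w i j

-- x_m, with x_0 = (0) so that x_1 = (0,1)
xs : ℕ → List ℕ
xs zero    = 0 ∷ []
xs (suc m) = concatMap (λ a → a ∷ (a + 2 ^ m) ∷ []) (xs m)

ys : ℕ → List ℕ
ys m = reverse (xs m)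

InBasic : ℕ → ℕ → ℕ → Set
InBasic k c i = (c * 2 ^ k ≤ i) × (i < suc c * 2 ^ k)

DWD : ℕ → List ℕ → Set
DWD m w = ∀ k₁ k₂ → k₁ + k₂ ≡ m → ∀ c d → c < 2 ^ k₂ → d < 2 ^ k₁ →
  Σ ℕ (λ i → (i < length w) × InBasic k₁ c i × InBasic k₂ d (at w i) ×
             (∀ j → j < length w → InBasic k₁ c j → InBasic k₂ d (at w j) → j ≡ i))

-- The rank r_w(n, b) = #{p < n ∣ w(p) < b} can only decrease along a Bruhat chain: a
-- length-increasing transposition exchanges an ascent w(i) < w(j) for a descent, which
-- never increases a prefix count. At every corner (c 2^k₁, d 2^k₂) of the dyadic grid
-- with k₁ + k₂ = m, both x_m and y_m have rank c d (induction along the doubling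
-- construction), so every w between them has these ranks too. The ranks at the four
-- corners of a dyadic box then count exactly (c+1)(d+1) - (c+1)d - c(d+1) + cd = 1
-- point of w inside it.

module Submission where

open import Data.Bool using (Bool; true; false)
open import Data.Empty using (⊥-elim)
open import Data.List
  using (List; []; _∷_; [_]; _++_; length; filter; take; drop; concatMap; reverse; upTo)
open import Data.List.Properties
  using (length-++; length-take; take-[]; filter-++; filter-all; filter-none; reverse-++;
         concatMap-++; unfold-reverse)
open import Data.List.Relation.Binary.Permutation.Propositional using (_↭_)
open import Data.List.Relation.Unary.All as All using (All; []; _∷_)
open import Data.List.Relation.Unary.All.Properties using (++⁺; take⁺)
open import Data.Nat
  using (ℕ; zero; suc; _+_; _*_; _∸_; _^_; _⊓_; _≤_; _<_; _<?_; _≤?_; z≤n; s≤s)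
open import Data.Nat.Properties
open import Algebra.Properties.CommutativeSemigroup +-commutativeSemigroup using (interchange)
open import Data.Nat.Tactic.RingSolver using (solve-∀)
open import Data.Product using (Σ; _×_; _,_)
open import Function.Base using (id)
open import Level using (Level)
open import Relation.Binary.PropositionalEquality
  using (_≡_; refl; sym; trans; cong; cong₂; subst; subst₂; module ≡-Reasoning)
open import Relation.Nullary using (yes; no; ¬_)
open import Relation.Nullary.Decidable using (_×-dec_)
open import Relation.Unary using (Pred; Decidable)

open import Defs

private
  variable
    ℓ p q : Level
    A : Set ℓ

count : {P : Pred A p} → Decidable P → List A → ℕ
count P? xs = length (filter P? xs)

module _ {P : Pred A p} (P? : Decidable P) where

  count-++ : ∀ xs ys → count P? (xs ++ ys) ≡ count P? xs + count P? ys
  count-++ xs ys = trans (cong length (filter-++ P? xs ys)) (length-++ (filter P? xs))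

  count-++-∷ : ∀ xs y zs →
               count P? (xs ++ y ∷ zs) ≡ count P? xs + (count P? [ y ] + count P? zs)
  count-++-∷ xs y zs = trans (count-++ xs (y ∷ zs)) (cong (count P? xs +_) (count-++ [ y ] zs))

  count-swap : ∀ xs y ys z zs →
               count P? (xs ++ y ∷ ys ++ z ∷ zs) ≡ count P? (xs ++ z ∷ ys ++ y ∷ zs)
  count-swap xs y ys z zs = begin
    count P? (xs ++ y ∷ ys ++ z ∷ zs)
      ≡⟨ count-++-∷ xs y (ys ++ z ∷ zs) ⟩
    count P? xs + (count P? [ y ] + count P? (ys ++ z ∷ zs))
      ≡⟨ cong (λ t → count P? xs + (count P? [ y ] + t)) (count-++-∷ ys z zs) ⟩
    count P? xs + (count P? [ y ] + (count P? ys + (count P? [ z ] + count P? zs)))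
      ≡⟨ cong (count P? xs +_)
           (exchange (count P? [ y ]) (count P? ys) (count P? [ z ]) (count P? zs)) ⟩
    count P? xs + (count P? [ z ] + (count P? ys + (count P? [ y ] + count P? zs)))
      ≡⟨ cong (λ t → count P? xs + (count P? [ z ] + t)) (count-++-∷ ys y zs) ⟨
    count P? xs + (count P? [ z ] + count P? (ys ++ y ∷ zs))
      ≡⟨ count-++-∷ xs z (ys ++ y ∷ zs) ⟨
    count P? (xs ++ z ∷ ys ++ y ∷ zs) ∎
    where
    open ≡-Reasoning
    exchange : ∀ a b c d → a + (b + (c + d)) ≡ c + (b + (a + d))
    exchange = solve-∀

  count-all : ∀ {xs} → All P xs → count P? xs ≡ length xs
  count-all Pxs = cong length (filter-all P? Pxs)

  count-none : ∀ {xs} → All (λ x → ¬ P x) xs → count P? xs ≡ 0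
  count-none ¬Pxs = cong length (filter-none P? ¬Pxs)

  count-[]-accept : ∀ {x} → P x → count P? [ x ] ≡ 1
  count-[]-accept Px = count-all (Px ∷ [])

  count-[]-reject : ∀ {x} → ¬ P x → count P? [ x ] ≡ 0
  count-[]-reject ¬Px = count-none (¬Px ∷ [])

module _ {P : Pred A p} {Q : Pred A q} (P? : Decidable P) (Q? : Decidable Q) where

  count-[]-mono : ∀ {x y} → (P x → Q y) → count P? [ x ] ≤ count Q? [ y ]
  count-[]-mono {x} {y} Px⇒Qy with P? x | Q? y
  ... | yes Px | no ¬Qy = ⊥-elim (¬Qy (Px⇒Qy Px))
  ... | yes _  | yes _  = ≤-refl
  ... | no  _  | _      = z≤n

  count-mono : ∀ {xs} → All (λ x → P x → Q x) xs → count P? xs ≤ count Q? xs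
  count-mono {[]}     []           = z≤n
  count-mono {x ∷ xs} (P⇒Q ∷ P⇒Qs) with P? x | Q? x
  ... | yes Px | yes _  = s≤s (count-mono P⇒Qs)
  ... | yes Px | no ¬Qx = ⊥-elim (¬Qx (P⇒Q Px))
  ... | no _   | yes _  = m≤n⇒m≤1+n (count-mono P⇒Qs)
  ... | no _   | no _   = count-mono P⇒Qs

module _ {P : Pred A p} {Q : Pred A q} (P? : Decidable P) (Q? : Decidable Q) where

  count-[]-cong : ∀ {x y} → (P x → Q y) → (Q y → P x) → count P? [ x ] ≡ count Q? [ y ]
  count-[]-cong Px⇒Qy Qy⇒Px =
    ≤-antisym (count-[]-mono P? Q? Px⇒Qy) (count-[]-mono Q? P? Qy⇒Px)

  count-cong : ∀ {xs} → All (λ x → P x → Q x) xs → All (λ x → Q x → P x) xs →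
               count P? xs ≡ count Q? xs
  count-cong P⇒Q Q⇒P = ≤-antisym (count-mono P? Q? P⇒Q) (count-mono Q? P? Q⇒P)

-- Inversions and transpositions

setAt-split : ∀ (w : List ℕ) {j} → j < length w → ∀ x →
              Σ (List ℕ) λ B → Σ (List ℕ) λ C →
                (w ≡ B ++ at w j ∷ C) × (setAt w j x ≡ B ++ x ∷ C)
setAt-split (y ∷ w) {zero}  _        x = [] , w , refl , refl
setAt-split (y ∷ w) {suc j} (s≤s j<) x with setAt-split w j< x
... | B , C , w≡ , w′≡ = y ∷ B , C , cong (y ∷_) w≡ , cong (y ∷_) w′≡

swapPos-split : ∀ (w : List ℕ) {i j} → i < j → j < length w →
                Σ (List ℕ) λ A → Σ (List ℕ) λ B → Σ (List ℕ) λ C →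
                  (w ≡ A ++ at w i ∷ B ++ at w j ∷ C) ×
                  (swapPos w i j ≡ A ++ at w j ∷ B ++ at w i ∷ C)
swapPos-split (x ∷ w) {zero}  {suc j} _        (s≤s j<) with setAt-split w j< x
... | B , C , w≡ , w′≡ = [] , B , C , cong (x ∷_) w≡ , cong (at w j ∷_) w′≡
swapPos-split (x ∷ w) {suc i} {suc j} (s≤s i<j) (s≤s j<) with swapPos-split w i<j j<
... | A , B , C , w≡ , w′≡ = x ∷ A , B , C , cong (x ∷_) w≡ , cong (x ∷_) w′≡

inv-insert : ∀ B x C → inv (B ++ x ∷ C) ≡ inv (B ++ C) + count (x <?_) B + count (_<? x) C
inv-insert []      x C =
  trans (+-comm (count (_<? x) C) (inv C)) (cong (_+ count (_<? x) C) (sym (+-identityʳ (inv C))))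
inv-insert (b ∷ B) x C = begin
  count (_<? b) (B ++ x ∷ C) + inv (B ++ x ∷ C)
    ≡⟨ cong₂ _+_ (count-++-∷ (_<? b) B x C) (inv-insert B x C) ⟩
  (β + (ι + γ)) + (inv (B ++ C) + count (x <?_) B + count (_<? x) C)
    ≡⟨ shuffle β ι γ (inv (B ++ C)) (count (x <?_) B) (count (_<? x) C) ⟩
  (β + γ + inv (B ++ C)) + (ι + count (x <?_) B) + count (_<? x) C
    ≡⟨ cong₂ (λ s t → s + inv (B ++ C) + t + count (_<? x) C)
         (sym (count-++ (_<? b) B C))
         (trans (cong (_+ count (x <?_) B) (count-[]-cong (_<? b) (x <?_) id id))
                (sym (count-++ (x <?_) [ b ] B))) ⟩
  inv (b ∷ B ++ C) + count (x <?_) (b ∷ B) + count (_<? x) C ∎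
  where
  open ≡-Reasoning
  β = count (_<? b) B
  ι = count (_<? b) [ x ]
  γ = count (_<? b) C
  shuffle : ∀ a b c d e f → (a + (b + c)) + (d + e + f) ≡ (a + c + d) + (b + e) + f
  shuffle = solve-∀

inv-pair : ∀ x B y C → inv (x ∷ B ++ y ∷ C) ≡
           (count (_<? x) B + count (y <?_) B + count (_<? x) [ y ]) +
           (count (_<? x) C + count (_<? y) C + inv (B ++ C))
inv-pair x B y C = begin
  count (_<? x) (B ++ y ∷ C) + inv (B ++ y ∷ C)
    ≡⟨ cong₂ _+_ (count-++-∷ (_<? x) B y C) (inv-insert B y C) ⟩
  (count (_<? x) B + (count (_<? x) [ y ] + count (_<? x) C)) +
  (inv (B ++ C) + count (y <?_) B + count (_<? y) C)
    ≡⟨ shuffle (count (_<? x) B) (count (_<? x) [ y ]) (count (_<? x) C)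
               (inv (B ++ C)) (count (y <?_) B) (count (_<? y) C) ⟩
  (count (_<? x) B + count (y <?_) B + count (_<? x) [ y ]) +
  (count (_<? x) C + count (_<? y) C + inv (B ++ C)) ∎
  where
  open ≡-Reasoning
  shuffle : ∀ a b c d e f → (a + (b + c)) + (d + e + f) ≡ (a + e + b) + (c + f + d)
  shuffle = solve-∀

inv-swap-front-≤ : ∀ {u v} → v ≤ u → ∀ B C →
                   inv (v ∷ B ++ u ∷ C) ≤ inv (u ∷ B ++ v ∷ C)
inv-swap-front-≤ {u} {v} v≤u B C = begin
  inv (v ∷ B ++ u ∷ C)
    ≡⟨ inv-pair v B u C ⟩
  (count (_<? v) B + count (u <?_) B + count (_<? v) [ u ]) +
  (count (_<? v) C + count (_<? u) C + inv (B ++ C))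
    ≤⟨ +-mono-≤ (+-mono-≤ (+-mono-≤ <v≤<u u<≤v<) u<v≤v<u)
                (≤-reflexive (cong (_+ inv (B ++ C)) (+-comm (count (_<? v) C) _))) ⟩
  (count (_<? u) B + count (v <?_) B + count (_<? u) [ v ]) +
  (count (_<? u) C + count (_<? v) C + inv (B ++ C))
    ≡⟨ inv-pair u B v C ⟨
  inv (u ∷ B ++ v ∷ C) ∎
  where
  open ≤-Reasoning
  <v≤<u : count (_<? v) B ≤ count (_<? u) B
  <v≤<u = count-mono (_<? v) (_<? u) (All.universal (λ _ x<v → <-≤-trans x<v v≤u) B)
  u<≤v< : count (u <?_) B ≤ count (v <?_) B
  u<≤v< = count-mono (u <?_) (v <?_) (All.universal (λ _ u<x → ≤-<-trans v≤u u<x) B)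
  u<v≤v<u : count (_<? v) [ u ] ≤ count (_<? u) [ v ]
  u<v≤v<u = count-[]-mono (_<? v) (_<? u) (λ u<v → ⊥-elim (<⇒≱ u<v v≤u))

inv-swap-≤ : ∀ A {u v} → v ≤ u → ∀ B C →
             inv (A ++ v ∷ B ++ u ∷ C) ≤ inv (A ++ u ∷ B ++ v ∷ C)
inv-swap-≤ []      v≤u B C = inv-swap-front-≤ v≤u B C
inv-swap-≤ (z ∷ A) {u} {v} v≤u B C =
  +-mono-≤ (≤-reflexive (count-swap (_<? z) A v B u C)) (inv-swap-≤ A v≤u B C)

inv<⇒ascent : ∀ A B C {u v} →
              inv (A ++ u ∷ B ++ v ∷ C) < inv (A ++ v ∷ B ++ u ∷ C) → u < v
inv<⇒ascent A B C {u} {v} inv< with u <? v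
... | yes u<v = u<v
... | no  u≮v = ⊥-elim (<⇒≱ inv< (inv-swap-≤ A (≮⇒≥ u≮v) B C))

-- Ranks are antitone in the Bruhat order

module _ {P : Pred A p} (P? : Decidable P) where

  count-∷-monoʳ : ∀ x {xs ys} → count P? xs ≤ count P? ys →
                  count P? (x ∷ xs) ≤ count P? (x ∷ ys)
  count-∷-monoʳ x xs≤ys with P? x
  ... | yes _ = s≤s xs≤ys
  ... | no  _ = xs≤ys

  module _ {u v : A} (Pv⇒Pu : P v → P u) where

    count-take-insert : ∀ B C n → count P? (take n (B ++ u ∷ C)) + count P? [ v ] ≤
                                  count P? (take n (B ++ v ∷ C)) + count P? [ u ]
    count-take-insert B       C zero    = count-[]-mono P? P? Pv⇒Pu
    count-take-insert []      C (suc n) = ≤-reflexive (begin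
      count P? (u ∷ take n C) + count P? [ v ]
        ≡⟨ cong (_+ count P? [ v ]) (count-++ P? [ u ] (take n C)) ⟩
      count P? [ u ] + count P? (take n C) + count P? [ v ]
        ≡⟨ exchange (count P? [ u ]) (count P? (take n C)) (count P? [ v ]) ⟩
      count P? [ v ] + count P? (take n C) + count P? [ u ]
        ≡⟨ cong (_+ count P? [ u ]) (count-++ P? [ v ] (take n C)) ⟨
      count P? (v ∷ take n C) + count P? [ u ] ∎)
      where
      open ≡-Reasoning
      exchange : ∀ a b c → a + b + c ≡ c + b + a
      exchange = solve-∀
    count-take-insert (b ∷ B) C (suc n) with P? b
    ... | yes _ = s≤s (count-take-insert B C n)
    ... | no  _ = count-take-insert B C n

    count-take-swap : ∀ A B C n → count P? (take n (A ++ v ∷ B ++ u ∷ C)) ≤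
                                  count P? (take n (A ++ u ∷ B ++ v ∷ C))
    count-take-swap A       B C zero    = z≤n
    count-take-swap []      B C (suc n) =
      subst₂ _≤_ (trans (+-comm _ (count P? [ v ])) (sym (count-++ P? [ v ] _)))
                 (trans (+-comm _ (count P? [ u ])) (sym (count-++ P? [ u ] _)))
                 (count-take-insert B C n)
    count-take-swap (z ∷ A) B C (suc n) = count-∷-monoʳ z (count-take-swap A B C n)

rank : List ℕ → ℕ → ℕ → ℕ
rank w n b = count (_<? b) (take n w)

rank-swap-≤ : ∀ {u v} → u < v → ∀ A B C n b →
              rank (A ++ v ∷ B ++ u ∷ C) n b ≤ rank (A ++ u ∷ B ++ v ∷ C) n b
rank-swap-≤ u<v A B C n b = count-take-swap (_<? b) (<-trans u<v) A B C n

≤B⇒rank-≥ : ∀ {u w} → u ≤B w → ∀ n b → rank w n b ≤ rank u n b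
≤B⇒rank-≥ ≤B-refl n b = ≤-refl
≤B⇒rank-≥ (≤B-step {w = w} i j i<j j<len u≤w inv<) n b with swapPos-split w i<j j<len
... | A , B , C , w≡ , w′≡ = ≤-trans swapped (≤B⇒rank-≥ u≤w n b)
  where
  ascent : at w i < at w j
  ascent = inv<⇒ascent A B C (subst₂ (λ x y → inv x < inv y) w≡ w′≡ inv<)
  swapped : rank (swapPos w i j) n b ≤ rank w n b
  swapped = subst₂ (λ x y → rank x n b ≤ rank y n b) (sym w′≡) (sym w≡)
                   (rank-swap-≤ ascent A B C n b)

-- Ranks of x_m and y_m on the dyadic grid

-- xs (suc m) is spread false (2 ^ m) (xs m) by definition; ys-spread describes ys (suc m).
block : Bool → ℕ → ℕ → List ℕ
block false N a = a ∷ a + N ∷ []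
block true  N a = a + N ∷ a ∷ []

spread : Bool → ℕ → List ℕ → List ℕ
spread flip N = concatMap (block flip N)

reverse-spread : ∀ N L → reverse (spread false N L) ≡ spread true N (reverse L)
reverse-spread N []      = refl
reverse-spread N (a ∷ L) = begin
  reverse (block false N a ++ spread false N L)
    ≡⟨ reverse-++ (block false N a) (spread false N L) ⟩
  reverse (spread false N L) ++ block true N a
    ≡⟨ cong (_++ block true N a) (reverse-spread N L) ⟩
  spread true N (reverse L) ++ block true N a
    ≡⟨ concatMap-++ (block true N) (reverse L) [ a ] ⟨
  spread true N (reverse L ++ [ a ])
    ≡⟨ cong (spread true N) (unfold-reverse a L) ⟨
  spread true N (reverse (a ∷ L)) ∎
  where open ≡-Reasoning

ys-spread : ∀ m → ys (suc m) ≡ spread true (2 ^ m) (ys m)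
ys-spread m = reverse-spread (2 ^ m) (xs m)

length-spread : ∀ flip N L → length (spread flip N L) ≡ 2 * length L
length-spread flip  N []      = refl
length-spread false N (a ∷ L) =
  trans (cong (2 +_) (length-spread false N L)) (sym (*-suc 2 (length L)))
length-spread true  N (a ∷ L) =
  trans (cong (2 +_) (length-spread true N L)) (sym (*-suc 2 (length L)))

spread-bounded : ∀ flip {N L} → All (_< N) L → All (_< 2 * N) (spread flip N L)
spread-bounded flip []             = []
spread-bounded flip {N} {a ∷ _} (a<N ∷ as<N) =
  ++⁺ (block-bounded flip) (spread-bounded flip as<N)
  where
  a<2N : a < 2 * N
  a<2N = <-≤-trans a<N (m≤m+n N (N + 0))
  a+N<2N : a + N < 2 * N
  a+N<2N = subst (a + N <_) (cong (N +_) (sym (+-identityʳ N))) (+-monoˡ-< N a<N)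
  block-bounded : ∀ flip → All (_< 2 * N) (block flip N a)
  block-bounded false = a<2N ∷ a+N<2N ∷ []
  block-bounded true  = a+N<2N ∷ a<2N ∷ []

take-spread : ∀ flip N n L → take (2 * n) (spread flip N L) ≡ spread flip N (take n L)
take-spread flip  N zero    L       = refl
take-spread flip  N (suc n) []      = refl
-- 2 * suc n unfolds to suc (n + suc (n + 0)); the rewrite exposes the second suc.
take-spread false N (suc n) (a ∷ L) rewrite +-suc n (n + 0) =
  cong (λ t → a ∷ a + N ∷ t) (take-spread false N n L)
take-spread true  N (suc n) (a ∷ L) rewrite +-suc n (n + 0) =
  cong (λ t → a + N ∷ a ∷ t) (take-spread true N n L)

count-<-shift : ∀ N b a → count (_<? b) [ a + N ] ≡ count (_<? b ∸ N) [ a ]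
count-<-shift N b a = count-[]-cong (_<? b) (_<? b ∸ N) (m+n≤o⇒m≤o∸n (suc a)) unshift
  where
  unshift : a < b ∸ N → a + N < b
  unshift a<b∸N = m≤o∸n⇒m+n≤o (suc a) (<⇒≤ (m∸n≢0⇒n<m (m<n⇒n≢0 a<b∸N))) a<b∸N

count-block : ∀ flip N b a →
              count (_<? b) (block flip N a) ≡ count (_<? b) [ a ] + count (_<? b ∸ N) [ a ]
count-block false N b a =
  trans (count-++ (_<? b) [ a ] [ a + N ]) (cong (count (_<? b) [ a ] +_) (count-<-shift N b a))
count-block true  N b a = begin
  count (_<? b) (a + N ∷ a ∷ [])
    ≡⟨ count-++ (_<? b) [ a + N ] [ a ] ⟩
  count (_<? b) [ a + N ] + count (_<? b) [ a ]
    ≡⟨ +-comm (count (_<? b) [ a + N ]) (count (_<? b) [ a ]) ⟩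
  count (_<? b) [ a ] + count (_<? b) [ a + N ]
    ≡⟨ cong (count (_<? b) [ a ] +_) (count-<-shift N b a) ⟩
  count (_<? b) [ a ] + count (_<? b ∸ N) [ a ] ∎
  where open ≡-Reasoning

count-spread : ∀ flip N b L →
               count (_<? b) (spread flip N L) ≡ count (_<? b) L + count (_<? b ∸ N) L
count-spread flip N b []      = refl
count-spread flip N b (a ∷ L) = begin
  count (_<? b) (block flip N a ++ spread flip N L)
    ≡⟨ count-++ (_<? b) (block flip N a) (spread flip N L) ⟩
  count (_<? b) (block flip N a) + count (_<? b) (spread flip N L)
    ≡⟨ cong₂ _+_ (count-block flip N b a) (count-spread flip N b L) ⟩
  (count (_<? b) [ a ] + count (_<? b ∸ N) [ a ]) + (count (_<? b) L + count (_<? b ∸ N) L)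
    ≡⟨ interchange (count (_<? b) [ a ]) (count (_<? b ∸ N) [ a ]) (count (_<? b) L) _ ⟩
  (count (_<? b) [ a ] + count (_<? b) L) + (count (_<? b ∸ N) [ a ] + count (_<? b ∸ N) L)
    ≡⟨ cong₂ _+_ (count-++ (_<? b) [ a ] L) (count-++ (_<? b ∸ N) [ a ] L) ⟨
  count (_<? b) (a ∷ L) + count (_<? b ∸ N) (a ∷ L) ∎
  where open ≡-Reasoning

rank-spread : ∀ flip N L n b → rank (spread flip N L) (2 * n) b ≡ rank L n b + rank L n (b ∸ N)
rank-spread flip N L n b =
  trans (cong (count (_<? b)) (take-spread flip N n L)) (count-spread flip N b (take n L))

rank-zero : ∀ w n → rank w n 0 ≡ 0
rank-zero w n = count-none (_<? 0) (All.universal (λ _ ()) (take n w))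

rank-full : ∀ {N w n} → All (_< N) w → n ≤ length w → rank w n N ≡ n
rank-full {N} {w} {n} w<N n≤ =
  trans (count-all (_<? N) (take⁺ n w<N)) (trans (length-take n w) (m≤n⇒m⊓n≡m n≤))

rank-saturate : ∀ {N w} → All (_< N) w → ∀ n b → rank w n b ≡ rank w n (N ⊓ b)
rank-saturate {N} {w} w<N n b = count-cong (_<? b) (_<? N ⊓ b)
  (All.map (λ x<N → ⊓-pres-m< x<N) (take⁺ n w<N))
  (All.universal (λ _ → m<n⊓o⇒m<o N b) (take n w))

DyadicRanks : ℕ → List ℕ → Set
DyadicRanks m w = ∀ k₁ k₂ → k₁ + k₂ ≡ m → ∀ c d → c ≤ 2 ^ k₂ → d ≤ 2 ^ k₁ →
                  rank w (c * 2 ^ k₁) (d * 2 ^ k₂) ≡ c * d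

record Dyadic (m : ℕ) (w : List ℕ) : Set where
  field
    bounded : All (_< 2 ^ m) w
    length≡ : length w ≡ 2 ^ m
    ranks   : DyadicRanks m w

rank-column : ∀ {N w} → All (_< N) w → length w ≡ N →
              ∀ c d → c ≤ N → d ≤ 1 → rank w (c * 1) (d * N) ≡ c * d
rank-column {w = w} _ _ c zero _ _ = trans (rank-zero w (c * 1)) (sym (*-zeroʳ c))
rank-column {N} {w} w<N len c (suc zero) c≤N _ = begin
  rank w (c * 1) (1 * N) ≡⟨ cong₂ (rank w) (*-identityʳ c) (*-identityˡ N) ⟩
  rank w c N             ≡⟨ rank-full w<N (subst (c ≤_) (sym len) c≤N) ⟩
  c                      ≡⟨ *-identityʳ c ⟨
  c * 1                  ∎
  where open ≡-Reasoning
rank-column _ _ _ (suc (suc _)) _ (s≤s ())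

-- The entries a of L account for the values below N = 2^k 2^k₂ and the entries a + N for
-- those above, so the row bound splits along d = (2^k ⊓ d) + (d ∸ 2^k).
rank-spread-grid : ∀ flip {k k₂ N L} → N ≡ 2 ^ k * 2 ^ k₂ → All (_< N) L →
                   (∀ c d → c ≤ 2 ^ k₂ → d ≤ 2 ^ k → rank L (c * 2 ^ k) (d * 2 ^ k₂) ≡ c * d) →
                   ∀ c d → c ≤ 2 ^ k₂ → d ≤ 2 ^ suc k →
                   rank (spread flip N L) (c * 2 ^ suc k) (d * 2 ^ k₂) ≡ c * d
rank-spread-grid flip {k} {k₂} {N} {L} N≡ L<N ranks c d c≤ d≤ = begin
  rank (spread flip N L) (c * (2 * K)) (d * H)
    ≡⟨ cong (λ n → rank (spread flip N L) n (d * H)) (double c K) ⟩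
  rank (spread flip N L) (2 * (c * K)) (d * H)
    ≡⟨ rank-spread flip N L (c * K) (d * H) ⟩
  rank L (c * K) (d * H) + rank L (c * K) (d * H ∸ N)
    ≡⟨ cong (_+ rank L (c * K) (d * H ∸ N)) (rank-saturate L<N (c * K) (d * H)) ⟩
  rank L (c * K) (N ⊓ (d * H)) + rank L (c * K) (d * H ∸ N)
    ≡⟨ cong₂ (λ s t → rank L (c * K) s + rank L (c * K) t) low high ⟩
  rank L (c * K) ((K ⊓ d) * H) + rank L (c * K) ((d ∸ K) * H)
    ≡⟨ cong₂ _+_ (ranks c (K ⊓ d) c≤ (m⊓n≤m K d)) (ranks c (d ∸ K) c≤ d∸K≤K) ⟩
  c * (K ⊓ d) + c * (d ∸ K)
    ≡⟨ *-distribˡ-+ c (K ⊓ d) (d ∸ K) ⟨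
  c * (K ⊓ d + (d ∸ K))
    ≡⟨ cong (c *_) (m⊓n+n∸m≡n K d) ⟩
  c * d ∎
  where
  open ≡-Reasoning
  K = 2 ^ k
  H = 2 ^ k₂
  double : ∀ c K → c * (2 * K) ≡ 2 * (c * K)
  double = solve-∀
  low : N ⊓ (d * H) ≡ (K ⊓ d) * H
  low = trans (cong (λ n → n ⊓ (d * H)) N≡) (sym (*-distribʳ-⊓ H K d))
  high : d * H ∸ N ≡ (d ∸ K) * H
  high = trans (cong (d * H ∸_) N≡) (sym (*-distribʳ-∸ H d K))
  d∸K≤K : d ∸ K ≤ K
  d∸K≤K = subst (d ∸ K ≤_) (+-identityʳ K) (m≤n+o⇒m∸n≤o d K d≤)

spread-Dyadic : ∀ flip {m L} → Dyadic m L → Dyadic (suc m) (spread flip (2 ^ m) L)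
spread-Dyadic flip {m} {L} D =
  record { bounded = L′<2N ; length≡ = length≡′ ; ranks = ranks′ }
  where
  open Dyadic D
  L′<2N : All (_< 2 ^ suc m) (spread flip (2 ^ m) L)
  L′<2N = spread-bounded flip bounded
  length≡′ : length (spread flip (2 ^ m) L) ≡ 2 ^ suc m
  length≡′ = trans (length-spread flip (2 ^ m) L) (cong (2 *_) length≡)
  ranks′ : DyadicRanks (suc m) (spread flip (2 ^ m) L)
  ranks′ zero    k₂ refl    = rank-column L′<2N length≡′
  ranks′ (suc k) k₂ k+k₂≡m =
    rank-spread-grid flip {k} {k₂} 2^m≡ bounded (ranks k k₂ (suc-injective k+k₂≡m))
    where
    2^m≡ : 2 ^ m ≡ 2 ^ k * 2 ^ k₂
    2^m≡ = trans (cong (2 ^_) (sym (suc-injective k+k₂≡m))) (^-distribˡ-+-* 2 k k₂)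

singleton-Dyadic : Dyadic 0 [ 0 ]
singleton-Dyadic = record { bounded = bounded ; length≡ = refl ; ranks = ranks }
  where
  bounded : All (_< 1) [ 0 ]
  bounded = s≤s z≤n ∷ []
  ranks : DyadicRanks 0 [ 0 ]
  ranks zero zero refl = rank-column bounded refl

xs-Dyadic : ∀ m → Dyadic m (xs m)
xs-Dyadic zero    = singleton-Dyadic
xs-Dyadic (suc m) = spread-Dyadic false (xs-Dyadic m)

ys-Dyadic : ∀ m → Dyadic m (ys m)
ys-Dyadic zero    = singleton-Dyadic
ys-Dyadic (suc m) = subst (Dyadic (suc m)) (sym (ys-spread m)) (spread-Dyadic true (ys-Dyadic m))

-- One point in each dyadic box

module _ {P : Pred ℕ p} (P? : Decidable P) where

  count≡0⇒¬at : ∀ xs → count P? xs ≡ 0 → ∀ {r} → r < length xs → ¬ P (at xs r)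
  count≡0⇒¬at (x ∷ xs) c≡0 {r} r< with P? x
  count≡0⇒¬at (x ∷ xs) ()  {r}       r<       | yes _
  count≡0⇒¬at (x ∷ xs) c≡0 {zero}    _        | no ¬Px = ¬Px
  count≡0⇒¬at (x ∷ xs) c≡0 {suc r}   (s≤s r<) | no _   = count≡0⇒¬at xs c≡0 r<

  count≡1⇒∃!at : ∀ xs → count P? xs ≡ 1 →
                 Σ ℕ λ r → (r < length xs × P (at xs r)) ×
                           (∀ {s} → s < length xs → P (at xs s) → s ≡ r)
  count≡1⇒∃!at (x ∷ xs) c≡1 with P? x
  ... | yes Px = 0 , (s≤s z≤n , Px) , unique
    where
    unique : ∀ {s} → s < suc (length xs) → P (at (x ∷ xs) s) → s ≡ 0
    unique {zero}  _        _  = refl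
    unique {suc s} (s≤s s<) Ps = ⊥-elim (count≡0⇒¬at xs (suc-injective c≡1) s< Ps)
  ... | no ¬Px with count≡1⇒∃!at xs c≡1
  ...   | r , (r< , Pr) , unique = suc r , (s≤s r< , Pr) , unique′
    where
    unique′ : ∀ {s} → s < suc (length xs) → P (at (x ∷ xs) s) → s ≡ suc r
    unique′ {zero}  _        Px′ = ⊥-elim (¬Px Px′)
    unique′ {suc s} (s≤s s<) Ps  = cong suc (unique s< Ps)

take-+ : ∀ a K (w : List A) → take (a + K) w ≡ take a w ++ take K (drop a w)
take-+ zero    K w       = refl
take-+ (suc a) K []      = sym (take-[] K)
take-+ (suc a) K (x ∷ w) = cong (x ∷_) (take-+ a K w)

rank-window : ∀ w a K b → rank w (a + K) b ≡ rank w a b + count (_<? b) (take K (drop a w))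
rank-window w a K b = trans (cong (count (_<? b)) (take-+ a K w)) (count-++ (_<? b) (take a w) _)

at-take : ∀ (w : List ℕ) {K r} → r < K → at (take K w) r ≡ at w r
at-take []      {suc K}         _        = refl
at-take (x ∷ w) {suc K} {zero}  _        = refl
at-take (x ∷ w) {suc K} {suc r} (s≤s r<) = at-take w r<

at-drop : ∀ a (w : List ℕ) r → at (drop a w) r ≡ at w (a + r)
at-drop zero    w       r = refl
at-drop (suc a) []      r = refl
at-drop (suc a) (x ∷ w) r = at-drop a w r

<-length-drop⁻ : ∀ a (w : List A) {r} → r < length (drop a w) → a + r < length w
<-length-drop⁻ zero    w       r<        = r<
<-length-drop⁻ (suc a) (x ∷ w) r<        = s≤s (<-length-drop⁻ a w r<)

<-length-drop⁺ : ∀ a (w : List A) {r} → a + r < length w → r < length (drop a w)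
<-length-drop⁺ zero    w       a+r<       = a+r<
<-length-drop⁺ (suc a) (x ∷ w) (s≤s a+r<) = <-length-drop⁺ a w a+r<

inRange? : ∀ b₁ b₂ → Decidable (λ x → b₁ ≤ x × x < b₂)
inRange? b₁ b₂ x = (b₁ ≤? x) ×-dec (x <? b₂)

count-<-split : ∀ {b₁ b₂} → b₁ ≤ b₂ → ∀ xs →
                count (_<? b₂) xs ≡ count (_<? b₁) xs + count (inRange? b₁ b₂) xs
count-<-split b₁≤b₂ []       = refl
count-<-split {b₁} {b₂} b₁≤b₂ (x ∷ xs) = begin
  below₂ (x ∷ xs)
    ≡⟨ count-++ (_<? b₂) [ x ] xs ⟩
  below₂ [ x ] + below₂ xs
    ≡⟨ cong₂ _+_ split-x (count-<-split b₁≤b₂ xs) ⟩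
  (below₁ [ x ] + between [ x ]) + (below₁ xs + between xs)
    ≡⟨ interchange (below₁ [ x ]) (between [ x ]) (below₁ xs) (between xs) ⟩
  (below₁ [ x ] + below₁ xs) + (between [ x ] + between xs)
    ≡⟨ cong₂ _+_ (count-++ (_<? b₁) [ x ] xs) (count-++ (inRange? b₁ b₂) [ x ] xs) ⟨
  below₁ (x ∷ xs) + between (x ∷ xs) ∎
  where
  open ≡-Reasoning
  below₁ below₂ between : List ℕ → ℕ
  below₁  = count (_<? b₁)
  below₂  = count (_<? b₂)
  between = count (inRange? b₁ b₂)
  split-x : below₂ [ x ] ≡ below₁ [ x ] + between [ x ]
  split-x with x <? b₁ | x <? b₂
  ... | yes x<b₁ | _        = trans (count-[]-accept (_<? b₂) (<-≤-trans x<b₁ b₁≤b₂)) (sym (cong₂ _+_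
    (count-[]-accept (_<? b₁) x<b₁) (count-[]-reject (inRange? b₁ b₂) (λ (b₁≤x , _) → <⇒≱ x<b₁ b₁≤x))))
  ... | no x≮b₁ | yes x<b₂ = trans (count-[]-accept (_<? b₂) x<b₂) (sym (cong₂ _+_
    (count-[]-reject (_<? b₁) x≮b₁) (count-[]-accept (inRange? b₁ b₂) (≮⇒≥ x≮b₁ , x<b₂))))
  ... | no x≮b₁ | no x≮b₂  = trans (count-[]-reject (_<? b₂) x≮b₂) (sym (cong₂ _+_
    (count-[]-reject (_<? b₁) x≮b₁) (count-[]-reject (inRange? b₁ b₂) (λ (_ , x<b₂) → x≮b₂ x<b₂))))

window-unique : ∀ {P : Pred ℕ p} (P? : Decidable P) w a K →
                count P? (take K (drop a w)) ≡ 1 →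
                Σ ℕ λ i → i < length w × (a ≤ i × i < K + a) × P (at w i) ×
                          (∀ j → j < length w → (a ≤ j × j < K + a) → P (at w j) → j ≡ i)
window-unique {P = P} P? w a K count≡1 with count≡1⇒∃!at P? (take K (drop a w)) count≡1
... | r , (r<len , Pr) , r-unique =
  a + r , <-length-drop⁻ a w r<len-drop , (m≤m+n a r , a+r<K+a) ,
  subst P (at-window r<K) Pr , unique
  where
  at-window : ∀ {s} → s < K → at (take K (drop a w)) s ≡ at w (a + s)
  at-window {s} s<K = trans (at-take (drop a w) s<K) (at-drop a w s)
  r<K⊓len-drop : r < K ⊓ length (drop a w)
  r<K⊓len-drop = subst (r <_) (length-take K (drop a w)) r<len
  r<K : r < K
  r<K = m<n⊓o⇒m<n K _ r<K⊓len-drop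
  r<len-drop : r < length (drop a w)
  r<len-drop = m<n⊓o⇒m<o K _ r<K⊓len-drop
  a+r<K+a : a + r < K + a
  a+r<K+a = subst (a + r <_) (+-comm a K) (+-monoʳ-< a r<K)
  unique : ∀ j → j < length w → (a ≤ j × j < K + a) → P (at w j) → j ≡ a + r
  unique j j<len (a≤j , j<K+a) Pj = trans (sym a+s≡j) (cong (a +_) (r-unique s<len Ps))
    where
    s = j ∸ a
    a+s≡j : a + s ≡ j
    a+s≡j = m+[n∸m]≡n a≤j
    s<K : s < K
    s<K = subst (s <_) (m+n∸n≡m K a) (∸-monoˡ-< j<K+a a≤j)
    s<len : s < length (take K (drop a w))
    s<len = subst (s <_) (sym (length-take K (drop a w)))
              (⊓-pres-m< s<K (<-length-drop⁺ a w (subst (_< length w) (sym a+s≡j) j<len)))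
    Ps : P (at (take K (drop a w)) s)
    Ps = subst P (sym (trans (at-window s<K) (cong (at w) a+s≡j))) Pj

-- In the window of positions [c 2^k₁, (c+1) 2^k₁), the ranks at its two ends leave exactly
-- e entries below e 2^k₂; comparing e = d and e = d + 1 leaves one entry in the box.
DyadicRanks⇒DWD : ∀ {m w} → DyadicRanks m w → DWD m w
DyadicRanks⇒DWD {w = w} ranks k₁ k₂ k₁+k₂≡m c d c< d< = window-unique box? w a K count-box
  where
  K = 2 ^ k₁
  H = 2 ^ k₂
  a = c * K
  window = take K (drop a w)
  box? = inRange? (d * H) (suc d * H)
  open ≡-Reasoning

  count-below : ∀ e → e ≤ K → count (_<? e * H) window ≡ e
  count-below e e≤K = +-cancelˡ-≡ (c * e) _ _ (begin
    c * e + count (_<? e * H) window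
      ≡⟨ cong (_+ count (_<? e * H) window) (ranks k₁ k₂ k₁+k₂≡m c e (<⇒≤ c<) e≤K) ⟨
    rank w a (e * H) + count (_<? e * H) window
      ≡⟨ rank-window w a K (e * H) ⟨
    rank w (a + K) (e * H)
      ≡⟨ cong (λ n → rank w n (e * H)) (+-comm a K) ⟩
    rank w (suc c * K) (e * H)
      ≡⟨ ranks k₁ k₂ k₁+k₂≡m (suc c) e c< e≤K ⟩
    suc c * e
      ≡⟨ +-comm e (c * e) ⟩
    c * e + e ∎)

  count-box : count box? window ≡ 1
  count-box = +-cancelˡ-≡ d _ _ (begin
    d + count box? window
      ≡⟨ cong (_+ count box? window) (count-below d (<⇒≤ d<)) ⟨
    count (_<? d * H) window + count box? window
      ≡⟨ count-<-split (m≤n+m (d * H) H) window ⟨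
    count (_<? suc d * H) window
      ≡⟨ count-below (suc d) d< ⟩
    suc d
      ≡⟨ +-comm 1 d ⟩
    d + 1 ∎)

DyadicRanks-between : ∀ {m u w v} → DyadicRanks m u → DyadicRanks m v → u ≤B w → w ≤B v →
                      DyadicRanks m w
DyadicRanks-between ranks-u ranks-v u≤w w≤v k₁ k₂ k₁+k₂≡m c d c≤ d≤ = ≤-antisym
  (≤-trans (≤B⇒rank-≥ u≤w n b) (≤-reflexive (ranks-u k₁ k₂ k₁+k₂≡m c d c≤ d≤)))
  (≤-trans (≤-reflexive (sym (ranks-v k₁ k₂ k₁+k₂≡m c d c≤ d≤))) (≤B⇒rank-≥ w≤v n b))
  where
  n = c * 2 ^ k₁
  b = d * 2 ^ k₂

lemma2p12 : ∀ (m : ℕ) → 1 ≤ m → ∀ (w : List ℕ) → w ↭ upTo (2 ^ m) →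
            xs m ≤B w → w ≤B ys m → DWD m w
lemma2p12 m _ w _ x≤w w≤y =
  DyadicRanks⇒DWD (DyadicRanks-between (ranks (xs-Dyadic m)) (ranks (ys-Dyadic m)) x≤w w≤y)
  where open Dyadic using (ranks)
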